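{- For all matches $(p,\sigma)$, $(q,\rho)$ of CPC patterns, if $p,\sigma\bowtie q,\rho$ then $p,\theta[\sigma]\bowtie q,\theta[\rho]$ for every substitution $\theta$.
   Context: For substitutions $\theta,\sigma$, $\theta[\sigma]$ is the substitution with domain ${\sf dom}(\sigma)$ mapping each $x\in{\sf dom}(\sigma)$ to $\theta(\sigma(x))$. Patterns: $p ::= \lambda x \mid x \mid \ulcorner x\urcorner \mid p\bullet p$ (binding, variable, protected name, compound); ${\sf vn},{\sf pn},{\sf bn}$ are variable, protected, binding names, ${\sf fn}={\sf vn}\cup{\sf pn}$; patterns are well formed (binding names distinct, disjoint from free names). Communicable patterns contain no protected or binding names. A substitution is a finite-domain partial map from names to communicable patterns, applied to patterns by $\sigma x=\sigma(x)$ if $x\in{\sf dom}(\sigma)$ else $x$, $\sigma\ulcorner x\urcorner=\ulcorner\sigma(x)\urcorner$ or $\ulcorner x\urcorner$, $\sigma(\lambda x)=\lambda x$, homomorphically on $\bullet$. $\hat\sigma$: $\hat\sigma x=x$, $\hat\sigma\ulcorner x\urcorner=\ulcorner x\urcorner$, $\hat\sigma(\lambda x)=\sigma(x)$ if $x\in{\sf dom}(\sigma)$ else $\lambda x$, $\hat\sigma(p\bullet q)=\hat\sigma p\bullet\hat\sigma q$. A match $(p,\sigma)$: ${\sf bn}(p)={\sf dom}(\sigma)$. Compatibility: $p,\sigma\bowtie\lambda y,\{\hat\sigma p/y\}$ if ${\sf fn}(p)=\emptyset$; $n,\{\}\bowtie n,\{\}$; $\ulcorner n\urcorner,\{\}\bowtie\ulcorner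 n\urcorner,\{\}$; $\ulcorner n\urcorner,\{\}\bowtie n,\{\}$; $p_1\bullet p_2,\sigma_1\cup\sigma_2\bowtie q_1\bullet q_2,\rho_1\cup\rho_2$ if $p_i,\sigma_i\bowtie q_i,\rho_i$ for $i=1,2$. -}

module Defs where

open import Data.Nat using (ℕ)
open import Data.List using (List; []; _∷_; _++_)
open import Data.List.Membership.Propositional using (_∈_)
open import Data.List.Relation.Unary.Unique.Propositional using (Unique)
open import Data.List.Relation.Unary.All using (All)
open import Data.Maybe using (Maybe; just; nothing; Is-just)
import Data.Maybe as Maybe
open import Data.Product using (Σ; ∃; _×_; _,_; proj₁; proj₂)
open import Relation.Binary.PropositionalEquality using (_≡_; refl; subst; sym)
open import Relation.Nullary using (¬_; yes; no)
open import Function.Bundles using (_⇔_)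
open import Data.Nat using (_≟_)
import Data.Maybe.Relation.Unary.Any as MA
open import Data.Unit using (tt)

Name : Set
Name = ℕ

-- Patterns  p ::= λx | x | ⌜x⌝ | p • p
data Pat : Set where
  bind : Name → Pat
  var  : Name → Pat
  prot : Name → Pat
  _•_  : Pat → Pat → Pat

infixl 6 _•_

vn : Pat → List Name
vn (bind x) = []
vn (var x)  = x ∷ []
vn (prot x) = []
vn (p • q)  = vn p ++ vn q

pn : Pat → List Name
pn (bind x) = []
pn (var x)  = []
pn (prot x) = x ∷ []
pn (p • q)  = pn p ++ pn q

bn : Pat → List Name
bn (bind x) = x ∷ []
bn (var x)  = []
bn (prot x) = []
bn (p • q)  = bn p ++ bn q

fn : Pat → List Name
fn p = vn p ++ pn p

WellFormed : Pat → Set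
WellFormed p = Unique (bn p) × (∀ x → x ∈ bn p → ¬ (x ∈ fn p))

data Communicable : Pat → Set where
  var : ∀ x → Communicable (var x)
  _•_ : ∀ {p q} → Communicable p → Communicable q → Communicable (p • q)

record Subst : Set where
  field
    map    : Name → Maybe Pat
    finite : ∃ λ (l : List Name) → ∀ x → Is-just (map x) → x ∈ l
    comm   : ∀ x p → map x ≡ just p → Communicable p
open Subst public

_∈dom_ : Name → Subst → Set
x ∈dom σ = Is-just (map σ x)

protect : Pat → Pat
protect (bind x) = bind x
protect (var x)  = prot x
protect (prot x) = prot x
protect (p • q)  = protect p • protect q

substVar : Name → Maybe Pat → Pat
substVar x nothing  = var x
substVar x (just p) = p

substProt : Name → Maybe Pat → Pat
substProt x nothing  = prot x
substProt x (just p) = protect p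

_·_ : Subst → Pat → Pat
σ · bind x = bind x
σ · var x  = substVar x (map σ x)
σ · prot x = substProt x (map σ x)
σ · (p • q) = (σ · p) • (σ · q)

substBind : Name → Maybe Pat → Pat
substBind x nothing  = bind x
substBind x (just p) = p

hat : Subst → Pat → Pat
hat σ (bind x) = substBind x (map σ x)
hat σ (var x)  = var x
hat σ (prot x) = prot x
hat σ (p • q)  = hat σ p • hat σ q

comm-· : ∀ θ p → Communicable p → Communicable (θ · p)
comm-· θ (var x) (var .x) with map θ x in eq
... | nothing = var x
... | just q  = comm θ x q eq
comm-· θ (p • q) (cp • cq) = comm-· θ p cp • comm-· θ q cq

infix 30 _[_]
_[_] : Subst → Subst → Subst
map    (θ [ σ ]) x = Maybe.map (θ ·_) (map σ x)
finite (θ [ σ ]) = proj₁ (finite σ) , fin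
  where
    fin : ∀ x → Is-just (Maybe.map (θ ·_) (map σ x)) → x ∈ proj₁ (finite σ)
    fin x j with map σ x in eq
    fin x () | nothing
    fin x j  | just p = proj₂ (finite σ) x (subst Is-just (sym eq) (MA.just tt))
comm   (θ [ σ ]) x p e with map σ x in eq
comm   (θ [ σ ]) x .(θ · q) refl | just q = comm-· θ q (comm σ x q eq)

_≈ₛ_ : Subst → Subst → Set
σ ≈ₛ ρ = ∀ x → map σ x ≡ map ρ x

IsEmpty : Subst → Set
IsEmpty σ = ∀ x → map σ x ≡ nothing

IsSingleton : Subst → Pat → Name → Set
IsSingleton σ p y = ∀ x → map σ x ≡ (if⌊ x ≟ y ⌋)
  where
    if⌊_⌋ : ∀ {a b : Name} → Relation.Nullary.Dec (a ≡ b) → Maybe Pat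
    if⌊ yes _ ⌋ = just p
    if⌊ no _ ⌋  = nothing

IsUnion : Subst → Subst → Subst → Set
IsUnion σ σ₁ σ₂ = ∀ x → map σ x ≡ Maybe._<∣>_ (map σ₁ x) (map σ₂ x)

Match : Pat → Subst → Set
Match p σ = ∀ x → (x ∈ bn p) ⇔ (x ∈dom σ)

infix 4 _,_⋈_,_
data _,_⋈_,_ : Pat → Subst → Pat → Subst → Set where
  bind⋈ : ∀ {p σ y ρ} → fn p ≡ [] → IsSingleton ρ (hat σ p) y →
          p , σ ⋈ bind y , ρ
  var⋈  : ∀ {n σ ρ} → IsEmpty σ → IsEmpty ρ → var n , σ ⋈ var n , ρ
  prot⋈ : ∀ {n σ ρ} → IsEmpty σ → IsEmpty ρ → prot n , σ ⋈ prot n , ρ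
  protvar⋈ : ∀ {n σ ρ} → IsEmpty σ → IsEmpty ρ → prot n , σ ⋈ var n , ρ
  •⋈    : ∀ {p₁ p₂ q₁ q₂ σ ρ} σ₁ σ₂ ρ₁ ρ₂ →
          IsUnion σ σ₁ σ₂ → IsUnion ρ ρ₁ ρ₂ →
          p₁ , σ₁ ⋈ q₁ , ρ₁ → p₂ , σ₂ ⋈ q₂ , ρ₂ →
          (p₁ • p₂) , σ ⋈ (q₁ • q₂) , ρ

{-# OPTIONS --safe #-}
module Submission where

open import Defs
open import Data.List using ([])
open import Data.List.Properties using (++-conicalˡ; ++-conicalʳ)
open import Data.Maybe as Maybe using (just; nothing)
open import Data.Maybe.Properties using (map-<∣>)
open import Data.Nat using (_≟_)
open import Relation.Nullary using (yes; no)
open import Relation.Binary.PropositionalEquality using (_≡_; refl; cong; cong₂; trans)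

-- Composing with θ commutes with σ̂ on patterns without free names, since θ
-- then only acts on the patterns σ̂ puts in place of binding names.  Together
-- with the fact that θ[_] preserves empty, singleton and union substitutions,
-- this lets an induction on the compatibility derivation go through.

·-hat : ∀ θ σ p → vn p ≡ [] → pn p ≡ [] → θ · hat σ p ≡ hat (θ [ σ ]) p
·-hat θ σ (bind x) _ _ with map σ x
... | nothing = refl
... | just _  = refl
·-hat θ σ (p • q) vn≡[] pn≡[] = cong₂ _•_
  (·-hat θ σ p (++-conicalˡ (vn p) (vn q) vn≡[]) (++-conicalˡ (pn p) (pn q) pn≡[]))
  (·-hat θ σ q (++-conicalʳ (vn p) (vn q) vn≡[]) (++-conicalʳ (pn p) (pn q) pn≡[]))

[]-isEmpty : ∀ θ σ → IsEmpty σ → IsEmpty (θ [ σ ])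
[]-isEmpty θ _ empty x = cong (Maybe.map (θ ·_)) (empty x)

[]-isUnion : ∀ θ σ σ₁ σ₂ → IsUnion σ σ₁ σ₂ → IsUnion (θ [ σ ]) (θ [ σ₁ ]) (θ [ σ₂ ])
[]-isUnion θ _ σ₁ σ₂ union x =
  trans (cong (Maybe.map (θ ·_)) (union x)) (map-<∣> (θ ·_) (map σ₁ x) (map σ₂ x))

[]-isSingleton : ∀ θ σ ρ p y → fn p ≡ [] → IsSingleton ρ (hat σ p) y →
                 IsSingleton (θ [ ρ ]) (hat (θ [ σ ]) p) y
[]-isSingleton θ σ _ p y fn≡[] single x rewrite single x with x ≟ y
... | yes _ = cong just
  (·-hat θ σ p (++-conicalˡ (vn p) (pn p) fn≡[]) (++-conicalʳ (vn p) (pn p) fn≡[]))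
... | no _  = refl

⋈-[] : ∀ {p σ q ρ} → p , σ ⋈ q , ρ → ∀ θ → p , θ [ σ ] ⋈ q , θ [ ρ ]
⋈-[] {p} {σ} {bind y} {ρ} (bind⋈ fn≡[] single) θ =
  bind⋈ fn≡[] ([]-isSingleton θ σ ρ p y fn≡[] single)
⋈-[] {σ = σ} {ρ = ρ} (var⋈ σ-empty ρ-empty) θ =
  var⋈ ([]-isEmpty θ σ σ-empty) ([]-isEmpty θ ρ ρ-empty)
⋈-[] {σ = σ} {ρ = ρ} (prot⋈ σ-empty ρ-empty) θ =
  prot⋈ ([]-isEmpty θ σ σ-empty) ([]-isEmpty θ ρ ρ-empty)
⋈-[] {σ = σ} {ρ = ρ} (protvar⋈ σ-empty ρ-empty) θ =
  protvar⋈ ([]-isEmpty θ σ σ-empty) ([]-isEmpty θ ρ ρ-empty)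
⋈-[] {σ = σ} {ρ = ρ} (•⋈ σ₁ σ₂ ρ₁ ρ₂ σ-union ρ-union compat₁ compat₂) θ =
  •⋈ (θ [ σ₁ ]) (θ [ σ₂ ]) (θ [ ρ₁ ]) (θ [ ρ₂ ])
     ([]-isUnion θ σ σ₁ σ₂ σ-union) ([]-isUnion θ ρ ρ₁ ρ₂ ρ-union)
     (⋈-[] compat₁ θ) (⋈-[] compat₂ θ)

lemma3p14 : (p : Pat) (σ : Subst) (q : Pat) (ρ : Subst) →
              WellFormed p → WellFormed q →
              Match p σ → Match q ρ →
              p , σ ⋈ q , ρ →
              (θ : Subst) → p , θ [ σ ] ⋈ q , θ [ ρ ]
lemma3p14 _ _ _ _ _ _ _ _ compat = ⋈-[] compat
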